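{- Let $(G_1,G_2,S)$ be a constrained alignment instance with $m_2=1$, let $\Delta_1,\Delta_2$ be the maximum degrees of $G_1$ and $G_2$, and let $\Delta_{min}=\min(\Delta_1,\Delta_2)$. Then the $(2\Delta_{min}+2)$-claw is not an induced subgraph of the conflict graph $\mathcal{C}$.
   Context: Let $G_1=(V_1,E_1)$ and $G_2=(V_2,E_2)$ be finite simple undirected graphs with $V_1\cap V_2=\emptyset$, and let $S$ be a bipartite graph with parts $V_1,V_2$ in which every vertex of $V_1$ has degree at most $m_1$ and every vertex of $V_2$ has degree at most $m_2$ ($m_1$ a positive integer); edges of $S$ are similarity edges. A $c_4$ is a 4-cycle $a-b-c-d-a$ in $G_1\cup G_2\cup S$ with $a,b\in V_1$, $c,d\in V_2$, $ab\in E_1$, $cd\in E_2$, $ad,bc\in E(S)$, regarded as a subgraph. Two distinct $c_4$s conflict if their similarity edges cannot all belong to a common matching of $S$. The conflict graph $\mathcal{C}$ has one vertex per $c_4$ and an edge between each pair of conflicting $c_4$s. A $d$-claw is the graph consisting of an independent set of $d$ vertices (talons) and a center vertex adjacent to all of them, i.e. $K_{1,d}$. -}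

module Defs where

open import Data.Nat using (ℕ; _≤_; _⊔_; _⊓_; _+_; _*_)
open import Data.Fin using (Fin)
open import Data.Bool using (Bool; true; false)
open import Data.List using (List; []; _∷_; _++_; length; filter; map; foldr; allFin)
open import Data.List.Membership.Propositional using (_∈_)
open import Data.Product using (_×_; _,_; proj₁; proj₂; Σ)
open import Data.Sum using (_⊎_)
open import Relation.Nullary using (¬_)
open import Relation.Binary.PropositionalEquality using (_≡_; _≢_)
open import Data.Bool.Properties using (T?)
open import Data.Bool using (T)

record SimpleGraph (n : ℕ) : Set where
  field
    adj    : Fin n → Fin n → Bool
    sym    : ∀ u v → adj u v ≡ adj v u
    irrefl : ∀ v → adj v v ≡ false
open SimpleGraph public

countTrue : {n : ℕ} → (Fin n → Bool) → ℕ
countTrue {n} f = length (filter (λ j → T? (f j)) (allFin n))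

degree : {n : ℕ} → SimpleGraph n → Fin n → ℕ
degree G v = countTrue (adj G v)

maxDegree : {n : ℕ} → SimpleGraph n → ℕ
maxDegree {n} G = foldr _⊔_ 0 (map (degree G) (allFin n))

BipGraph : ℕ → ℕ → Set
BipGraph n₁ n₂ = Fin n₁ → Fin n₂ → Bool

degS₁ : {n₁ n₂ : ℕ} → BipGraph n₁ n₂ → Fin n₁ → ℕ
degS₁ S v = countTrue (S v)

degS₂ : {n₁ n₂ : ℕ} → BipGraph n₁ n₂ → Fin n₂ → ℕ
degS₂ S w = countTrue (λ v → S v w)

record C4 {n₁ n₂ : ℕ} (G₁ : SimpleGraph n₁) (G₂ : SimpleGraph n₂)
          (S : BipGraph n₁ n₂) : Set where
  constructor c4
  field
    a b : Fin n₁
    c d : Fin n₂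
    ab∈E₁ : adj G₁ a b ≡ true
    cd∈E₂ : adj G₂ c d ≡ true
    ad∈S  : S a d ≡ true
    bc∈S  : S b c ≡ true
open C4 public

module _ {n₁ n₂ : ℕ} {G₁ : SimpleGraph n₁} {G₂ : SimpleGraph n₂}
         {S : BipGraph n₁ n₂} where

  -- Two c4s are the same subgraph iff their labelled quadruples agree
  -- up to the reversal a-b-c-d ↦ b-a-d-c (same vertex and edge sets).
  SameC4 : C4 G₁ G₂ S → C4 G₁ G₂ S → Set
  SameC4 P Q =
    (a P ≡ a Q × b P ≡ b Q × c P ≡ c Q × d P ≡ d Q)
    ⊎ (a P ≡ b Q × b P ≡ a Q × c P ≡ d Q × d P ≡ c Q)

  simEdges : C4 G₁ G₂ S → List (Fin n₁ × Fin n₂)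
  simEdges P = (a P , d P) ∷ (b P , c P) ∷ []

  IsMatching : List (Fin n₁ × Fin n₂) → Set
  IsMatching es = ∀ {e f} → e ∈ es → f ∈ es → e ≢ f →
                  (proj₁ e ≢ proj₁ f) × (proj₂ e ≢ proj₂ f)

  Conflict : C4 G₁ G₂ S → C4 G₁ G₂ S → Set
  Conflict P Q = ¬ SameC4 P Q × ¬ IsMatching (simEdges P ++ simEdges Q)

  record InducedClaw (k : ℕ) : Set where
    field
      center : C4 G₁ G₂ S
      talon  : Fin k → C4 G₁ G₂ S
      talons-distinct : ∀ i j → i ≢ j → ¬ SameC4 (talon i) (talon j)
      center-adj      : ∀ i → Conflict center (talon i)
      talons-indep    : ∀ i j → i ≢ j → ¬ Conflict (talon i) (talon j)

module Submission where

-- Since every vertex of V₂ has only one similarity neighbour, similarity edges with distinct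
-- V₁-endpoints are disjoint; so every talon of a claw centred at the c4 a − b − c − d passes
-- through a or b, and read from that vertex s it is a c4 s − o − z − y.  Two talons through the
-- same s do not conflict, so they share y, and they differ both in o (a G₁-neighbour of s) and in
-- z (a G₂-neighbour of y).  Hence there are at most 2Δ₁ and at most 2Δ₂ talons.

open import Defs renaming (sym to adj-sym)
open import Data.Nat using (ℕ; _≤_; _⊓_; _⊔_; _+_; _*_; s≤s)
open import Data.Nat.Properties
  using (≤-trans; +-mono-≤; +-identityʳ; m≤m⊔n; m≤n⊔m; ⊓-glb; *-distribˡ-⊓; m+1+n≰m)
open import Data.Fin using (Fin) renaming (_≟_ to _≟ᶠ_)
open import Data.Fin.Properties using (injective⇒≤; any?)
open import Data.Bool using (Bool; true; false; T) renaming (_≟_ to _≟ᵇ_)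
open import Data.Bool.Properties using (T?)
open import Data.Unit using (tt)
open import Data.Empty using (⊥-elim)
open import Data.List using (List; []; _∷_; _++_; length; filter; map; foldr; allFin)
open import Data.List.Properties using (length-++; length-map)
open import Data.List.Relation.Unary.All as All using ([]; _∷_)
open import Data.List.Relation.Unary.AllPairs using (AllPairs; []; _∷_)
open import Data.List.Relation.Unary.Any using (here; there)
open import Data.List.Membership.Propositional using (_∈_)
open import Data.List.Membership.Propositional.Properties using (∈-map⁺; ∈-filter⁺; ∈-allFin; ∈-++⁺ˡ; ∈-++⁺ʳ)
open import Data.List.Membership.Setoid.Properties using (index-injective)
open import Data.Product using (_×_; _,_; _,′_; proj₁; proj₂; Σ)
open import Data.Product.Properties using (≡-dec)
open import Data.Sum using (_⊎_; inj₁; inj₂; [_,_])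
open import Function.Definitions using (Injective)
open import Relation.Nullary using (¬_; yes; no)
open import Relation.Binary.PropositionalEquality
  using (_≡_; _≢_; ≢-sym; refl; sym; trans; cong; cong₂; subst; setoid)

injective∈⇒≤length : ∀ {A : Set} {K} {xs : List A} {f : Fin K → A} →
                     (∀ i → f i ∈ xs) → Injective _≡_ _≡_ f → K ≤ length xs
injective∈⇒≤length {A} f∈xs f-inj =
  injective⇒≤ (λ {i} {j} eq → f-inj (index-injective (setoid A) (f∈xs i) (f∈xs j) eq))

length≤1⇒unique : ∀ {A : Set} {x y : A} {xs : List A} → length xs ≤ 1 → x ∈ xs → y ∈ xs → x ≡ y
length≤1⇒unique {xs = _ ∷ []} _ (here refl) (here refl) = refl
length≤1⇒unique {xs = _ ∷ _ ∷ _} (s≤s ()) _ _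

trues : ∀ {n} → (Fin n → Bool) → List (Fin n)
trues {n} f = filter (λ j → T? (f j)) (allFin n)

∈-trues : ∀ {n} (f : Fin n → Bool) {u} → f u ≡ true → u ∈ trues f
∈-trues f {u} fu = ∈-filter⁺ (λ j → T? (f j)) (∈-allFin u) (subst T (sym fu) tt)

countTrue≤1⇒unique : ∀ {n} (f : Fin n → Bool) → countTrue f ≤ 1 →
                     ∀ {u v} → f u ≡ true → f v ≡ true → u ≡ v
countTrue≤1⇒unique f f≤1 fu fv = length≤1⇒unique f≤1 (∈-trues f fu) (∈-trues f fv)

∈⇒≤foldr-⊔ : ∀ {x} {xs : List ℕ} → x ∈ xs → x ≤ foldr _⊔_ 0 xs
∈⇒≤foldr-⊔ (here refl) = m≤m⊔n _ _
∈⇒≤foldr-⊔ {xs = y ∷ _} (there x∈xs) = ≤-trans (∈⇒≤foldr-⊔ x∈xs) (m≤n⊔m y _)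

degree≤maxDegree : ∀ {n} (G : SimpleGraph n) v → degree G v ≤ maxDegree G
degree≤maxDegree G v = ∈⇒≤foldr-⊔ (∈-map⁺ (degree G) (∈-allFin v))

adj⇒≢ : ∀ {n} (G : SimpleGraph n) {u v} → adj G u v ≡ true → u ≢ v
adj⇒≢ G {u} uv refl with trans (sym uv) (irrefl G u)
... | ()

neighbourhoods : ∀ {n} → SimpleGraph n → (Bool → Fin n) → List (Bool × Fin n)
neighbourhoods G v = map (true ,′_) (trues (adj G (v true))) ++ map (false ,′_) (trues (adj G (v false)))

∈-neighbourhoods : ∀ {n} (G : SimpleGraph n) (v : Bool → Fin n) {t u} →
                   adj G (v t) u ≡ true → (t , u) ∈ neighbourhoods G v
∈-neighbourhoods G v {true} vu = ∈-++⁺ˡ (∈-map⁺ (true ,′_) (∈-trues (adj G (v true)) vu))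
∈-neighbourhoods G v {false} vu = ∈-++⁺ʳ _ (∈-map⁺ (false ,′_) (∈-trues (adj G (v false)) vu))

length-neighbourhoods : ∀ {n} (G : SimpleGraph n) (v : Bool → Fin n) →
                        length (neighbourhoods G v) ≤ 2 * maxDegree G
length-neighbourhoods G v = begin
  length (map (true ,′_) Nt ++ map (false ,′_) Nf) ≡⟨ length-++ (map (true ,′_) Nt) ⟩
  length (map (true ,′_) Nt) + length (map (false ,′_) Nf)
                                         ≡⟨ cong₂ _+_ (length-map (true ,′_) Nt) (length-map (false ,′_) Nf) ⟩
  degree G (v true) + degree G (v false) ≤⟨ +-mono-≤ (degree≤maxDegree G _) (degree≤maxDegree G _) ⟩
  maxDegree G + maxDegree G              ≡⟨ cong (maxDegree G +_) (sym (+-identityʳ _)) ⟩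
  2 * maxDegree G                        ∎
  where
  open Data.Nat.Properties.≤-Reasoning
  Nt Nf : List (Fin _)
  Nt = trues (adj G (v true))
  Nf = trues (adj G (v false))

≤2*maxDegree : ∀ {n K} (G : SimpleGraph n) (v : Bool → Fin n) (side : Fin K → Bool) (u : Fin K → Fin n) →
               (∀ i → adj G (v (side i)) (u i) ≡ true) →
               (∀ i j → side i ≡ side j → u i ≡ u j → i ≡ j) →
               K ≤ 2 * maxDegree G
≤2*maxDegree G v side u adjacent distinct =
  ≤-trans (injective∈⇒≤length (λ i → ∈-neighbourhoods G v (adjacent i))
                              (λ {i} {j} eq → distinct i j (cong proj₁ eq) (cong proj₂ eq)))
          (length-neighbourhoods G v)

Disjoint : ∀ {A B : Set} → A × B → A × B → Set
Disjoint e f = proj₁ e ≢ proj₁ f × proj₂ e ≢ proj₂ f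

Disjoint-sym : ∀ {A B : Set} {e f : A × B} → Disjoint e f → Disjoint f e
Disjoint-sym (≢₁ , ≢₂) = ≢-sym ≢₁ , ≢-sym ≢₂

module _ {n₁ n₂ : ℕ} {G₁ : SimpleGraph n₁} {G₂ : SimpleGraph n₂} {S : BipGraph n₁ n₂} where

  AllPairs-Disjoint⇒IsMatching : ∀ {es} → AllPairs Disjoint es →
                                 IsMatching {G₁ = G₁} {G₂ = G₂} {S = S} es
  AllPairs-Disjoint⇒IsMatching _ (here refl) (here refl) e≢f = ⊥-elim (e≢f refl)
  AllPairs-Disjoint⇒IsMatching (disjoint ∷ _) (here refl) (there f∈es) _ = All.lookup disjoint f∈es
  AllPairs-Disjoint⇒IsMatching (disjoint ∷ _) (there e∈es) (here refl) _ =
    Disjoint-sym (All.lookup disjoint e∈es)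
  AllPairs-Disjoint⇒IsMatching (_ ∷ disjoint) (there e∈es) (there f∈es) e≢f =
    AllPairs-Disjoint⇒IsMatching disjoint e∈es f∈es e≢f

  end : C4 G₁ G₂ S → Bool → Fin n₁
  end P true = a P
  end P false = b P

  record Anchored (s : Fin n₁) (Q : C4 G₁ G₂ S) : Set where
    constructor anchored
    field
      other : Fin n₁
      rootMatch otherMatch : Fin n₂
      reading : (a Q ≡ s × b Q ≡ other × d Q ≡ rootMatch × c Q ≡ otherMatch)
              ⊎ (b Q ≡ s × a Q ≡ other × c Q ≡ rootMatch × d Q ≡ otherMatch)
  open Anchored

  anchored-adj₁ : ∀ {s Q} (A : Anchored s Q) → adj G₁ s (other A) ≡ true
  anchored-adj₁ {Q = Q} (anchored _ _ _ (inj₁ (refl , refl , _ , _))) = ab∈E₁ Q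
  anchored-adj₁ {Q = Q} (anchored _ _ _ (inj₂ (refl , refl , _ , _))) = trans (adj-sym G₁ _ _) (ab∈E₁ Q)

  anchored-adj₂ : ∀ {s Q} (A : Anchored s Q) → adj G₂ (rootMatch A) (otherMatch A) ≡ true
  anchored-adj₂ {Q = Q} (anchored _ _ _ (inj₁ (_ , _ , refl , refl))) = trans (adj-sym G₂ _ _) (cd∈E₂ Q)
  anchored-adj₂ {Q = Q} (anchored _ _ _ (inj₂ (_ , _ , refl , refl))) = cd∈E₂ Q

  root∈simEdges : ∀ {s Q} (A : Anchored s Q) → (s , rootMatch A) ∈ simEdges Q
  root∈simEdges (anchored _ _ _ (inj₁ (refl , _ , refl , _))) = here refl
  root∈simEdges (anchored _ _ _ (inj₂ (refl , _ , refl , _))) = there (here refl)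

  other∈simEdges : ∀ {s Q} (A : Anchored s Q) → (other A , otherMatch A) ∈ simEdges Q
  other∈simEdges (anchored _ _ _ (inj₁ (_ , refl , _ , refl))) = there (here refl)
  other∈simEdges (anchored _ _ _ (inj₂ (_ , refl , _ , refl))) = here refl

  anchored-SameC4 : ∀ {s s' Q Q'} (A : Anchored s Q) (A' : Anchored s' Q') → s ≡ s' →
                    other A ≡ other A' → rootMatch A ≡ rootMatch A' → otherMatch A ≡ otherMatch A' →
                    SameC4 Q Q'
  anchored-SameC4 (anchored _ _ _ (inj₁ (refl , refl , refl , refl))) (anchored _ _ _ (inj₁ (refl , refl , refl , refl)))
    ≡₁ ≡₂ ≡₃ ≡₄ = inj₁ (≡₁ , ≡₂ , ≡₄ , ≡₃)
  anchored-SameC4 (anchored _ _ _ (inj₁ (refl , refl , refl , refl))) (anchored _ _ _ (inj₂ (refl , refl , refl , refl)))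
    ≡₁ ≡₂ ≡₃ ≡₄ = inj₂ (≡₁ , ≡₂ , ≡₄ , ≡₃)
  anchored-SameC4 (anchored _ _ _ (inj₂ (refl , refl , refl , refl))) (anchored _ _ _ (inj₁ (refl , refl , refl , refl)))
    ≡₁ ≡₂ ≡₃ ≡₄ = inj₂ (≡₂ , ≡₁ , ≡₃ , ≡₄)
  anchored-SameC4 (anchored _ _ _ (inj₂ (refl , refl , refl , refl))) (anchored _ _ _ (inj₂ (refl , refl , refl , refl)))
    ≡₁ ≡₂ ≡₃ ≡₄ = inj₁ (≡₂ , ≡₁ , ≡₃ , ≡₄)

  module _ (S-functional : ∀ {v v' w} → S v w ≡ true → S v' w ≡ true → v ≡ v') where

    similarity-Disjoint : ∀ {x y x' y'} → S x y ≡ true → S x' y' ≡ true → x ≢ x' →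
                          Disjoint (x , y) (x' , y')
    similarity-Disjoint sxy sx'y' x≢x' = x≢x' , λ { refl → x≢x' (S-functional sxy sx'y') }

    -- If Q avoided both V₁-vertices of P, all four similarity edges would have distinct
    -- V₁-endpoints, hence (by functionality of S) form a matching.
    conflict⇒anchored : (P Q : C4 G₁ G₂ S) →
                        ¬ IsMatching {G₁ = G₁} {G₂ = G₂} {S = S} (simEdges P ++ simEdges Q) →
                        Σ Bool λ t → Anchored (end P t) Q
    conflict⇒anchored P Q ¬matching with a Q ≟ᶠ a P | b Q ≟ᶠ a P | a Q ≟ᶠ b P | b Q ≟ᶠ b P
    ... | yes aQ≡aP | _ | _ | _ = true , anchored (b Q) (d Q) (c Q) (inj₁ (aQ≡aP , refl , refl , refl))
    ... | no _ | yes bQ≡aP | _ | _ = true , anchored (a Q) (c Q) (d Q) (inj₂ (bQ≡aP , refl , refl , refl))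
    ... | no _ | no _ | yes aQ≡bP | _ = false , anchored (b Q) (d Q) (c Q) (inj₁ (aQ≡bP , refl , refl , refl))
    ... | no _ | no _ | no _ | yes bQ≡bP = false , anchored (a Q) (c Q) (d Q) (inj₂ (bQ≡bP , refl , refl , refl))
    ... | no aQ≢aP | no bQ≢aP | no aQ≢bP | no bQ≢bP = ⊥-elim (¬matching (AllPairs-Disjoint⇒IsMatching
          ( ( similarity-Disjoint (ad∈S P) (bc∈S P) (adj⇒≢ G₁ (ab∈E₁ P))
            ∷ similarity-Disjoint (ad∈S P) (ad∈S Q) (≢-sym aQ≢aP)
            ∷ similarity-Disjoint (ad∈S P) (bc∈S Q) (≢-sym bQ≢aP) ∷ [])
          ∷ ( similarity-Disjoint (bc∈S P) (ad∈S Q) (≢-sym aQ≢bP)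
            ∷ similarity-Disjoint (bc∈S P) (bc∈S Q) (≢-sym bQ≢bP) ∷ [])
          ∷ ( similarity-Disjoint (ad∈S Q) (bc∈S Q) (adj⇒≢ G₁ (ab∈E₁ Q)) ∷ [])
          ∷ [] ∷ [])))

    module ClawAnalysis {K : ℕ} (claw : InducedClaw {G₁ = G₁} {G₂ = G₂} {S = S} K) where
      open InducedClaw claw

      anchoring : ∀ i → Σ Bool λ t → Anchored (end center t) (talon i)
      anchoring i = conflict⇒anchored center (talon i) (proj₂ (center-adj i))

      side : Fin K → Bool
      side i = proj₁ (anchoring i)

      view : ∀ i → Anchored (end center (side i)) (talon i)
      view i = proj₂ (anchoring i)

      shared-endpoint⇒≡ : ∀ {i j} → i ≢ j → ∀ {e f} → e ∈ simEdges (talon i) → f ∈ simEdges (talon j) →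
                          proj₁ e ≡ proj₁ f ⊎ proj₂ e ≡ proj₂ f → e ≡ f
      shared-endpoint⇒≡ {i} {j} i≢j {e} {f} e∈ f∈ shared with ≡-dec _≟ᶠ_ _≟ᶠ_ e f
      ... | yes e≡f = e≡f
      ... | no e≢f = ⊥-elim (talons-indep i j i≢j (talons-distinct i j i≢j , λ matching →
            let (≢₁ , ≢₂) = matching (∈-++⁺ˡ e∈) (∈-++⁺ʳ (simEdges (talon i)) f∈) e≢f
            in [ ≢₁ , ≢₂ ] shared))

      sameSide⇒sameRootMatch : ∀ i j → side i ≡ side j → rootMatch (view i) ≡ rootMatch (view j)
      sameSide⇒sameRootMatch i j same with i ≟ᶠ j
      ... | yes refl = refl
      ... | no i≢j = cong proj₂ (shared-endpoint⇒≡ i≢j (root∈simEdges (view i)) (root∈simEdges (view j))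
                                                    (inj₁ (cong (end center) same)))

      sameOther⇒sameOtherMatch : ∀ {i j} → i ≢ j → other (view i) ≡ other (view j) →
                                 otherMatch (view i) ≡ otherMatch (view j)
      sameOther⇒sameOtherMatch {i} {j} i≢j same =
        cong proj₂ (shared-endpoint⇒≡ i≢j (other∈simEdges (view i)) (other∈simEdges (view j)) (inj₁ same))

      sameOtherMatch⇒sameOther : ∀ {i j} → i ≢ j → otherMatch (view i) ≡ otherMatch (view j) →
                                 other (view i) ≡ other (view j)
      sameOtherMatch⇒sameOther {i} {j} i≢j same =
        cong proj₁ (shared-endpoint⇒≡ i≢j (other∈simEdges (view i)) (other∈simEdges (view j)) (inj₂ same))

      sameOther⇒sameTalon : ∀ i j → side i ≡ side j → other (view i) ≡ other (view j) → i ≡ j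
      sameOther⇒sameTalon i j same same′ with i ≟ᶠ j
      ... | yes i≡j = i≡j
      ... | no i≢j = ⊥-elim (talons-distinct i j i≢j
            (anchored-SameC4 (view i) (view j) (cong (end center) same) same′
                             (sameSide⇒sameRootMatch i j same) (sameOther⇒sameOtherMatch i≢j same′)))

      sameOtherMatch⇒sameTalon : ∀ i j → side i ≡ side j → otherMatch (view i) ≡ otherMatch (view j) → i ≡ j
      sameOtherMatch⇒sameTalon i j same same′ with i ≟ᶠ j
      ... | yes i≡j = i≡j
      ... | no i≢j = sameOther⇒sameTalon i j same (sameOtherMatch⇒sameOther i≢j same′)

      -- The rootMatch shared by all talons on side t (junk value c center if there is none).
      sideMatch : Bool → Fin n₂
      sideMatch t with any? (λ j → side j ≟ᵇ t)
      ... | yes (j , _) = rootMatch (view j)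
      ... | no _ = c center

      rootMatch≡sideMatch : ∀ i → rootMatch (view i) ≡ sideMatch (side i)
      rootMatch≡sideMatch i with any? (λ j → side j ≟ᵇ side i)
      ... | yes (j , same) = sameSide⇒sameRootMatch i j (sym same)
      ... | no none = ⊥-elim (none (i , refl))

      size≤2*maxDegree₁ : K ≤ 2 * maxDegree G₁
      size≤2*maxDegree₁ = ≤2*maxDegree G₁ (end center) side (λ i → other (view i))
                                          (λ i → anchored-adj₁ (view i)) sameOther⇒sameTalon

      size≤2*maxDegree₂ : K ≤ 2 * maxDegree G₂
      size≤2*maxDegree₂ = ≤2*maxDegree G₂ sideMatch side (λ i → otherMatch (view i))
                                          adjacent sameOtherMatch⇒sameTalon
        where
        adjacent : ∀ i → adj G₂ (sideMatch (side i)) (otherMatch (view i)) ≡ true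
        adjacent i = subst (λ y → adj G₂ y (otherMatch (view i)) ≡ true)
                           (rootMatch≡sideMatch i) (anchored-adj₂ (view i))

theorem15 : {n₁ n₂ : ℕ} (G₁ : SimpleGraph n₁) (G₂ : SimpleGraph n₂)
            (S : BipGraph n₁ n₂) (m₁ : ℕ) → 1 ≤ m₁ →
            (∀ v → degS₁ S v ≤ m₁) → (∀ w → degS₂ S w ≤ 1) →
            ¬ InducedClaw {G₁ = G₁} {G₂ = G₂} {S = S}
                (2 * (maxDegree G₁ ⊓ maxDegree G₂) + 2)
theorem15 G₁ G₂ S _ _ _ degS₂≤1 claw = m+1+n≰m (2 * Δ) size≤2*Δ
  where
  S-functional : ∀ {v v' w} → S v w ≡ true → S v' w ≡ true → v ≡ v'
  S-functional {w = w} = countTrue≤1⇒unique (λ v → S v w) (degS₂≤1 w)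
  open ClawAnalysis S-functional claw
  open Data.Nat.Properties.≤-Reasoning

  Δ : ℕ
  Δ = maxDegree G₁ ⊓ maxDegree G₂

  size≤2*Δ : 2 * Δ + 2 ≤ 2 * Δ
  size≤2*Δ = begin
    2 * Δ + 2                                 ≤⟨ ⊓-glb size≤2*maxDegree₁ size≤2*maxDegree₂ ⟩
    (2 * maxDegree G₁) ⊓ (2 * maxDegree G₂)   ≡⟨ sym (*-distribˡ-⊓ 2 (maxDegree G₁) (maxDegree G₂)) ⟩
    2 * Δ                                     ∎
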